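{- Let $\mathbf L$ be a Latin square of order $n$. If the cells of $\mathbf L$ can be partitioned into sets $K_1,\dots,K_d$ where each $K_i$ is a $k_i$-plex (for some positive integers $k_1,\dots,k_d$), then $\chi(\mathbf L)\le 3n-2d$.
   Context: A Latin square $\mathbf L$ of order $n$ is an $n\times n$ array whose cells each contain one of $n$ symbols, with no symbol repeated in any row or column. A partial transversal is a set of cells no two of which share a row, a column, or a symbol; $\chi(\mathbf L)$ is the minimum number of partial transversals of $\mathbf L$ that together cover all cells of $\mathbf L$. A $k$-plex of $\mathbf L$ is a set of $kn$ cells containing exactly $k$ cells from each row, exactly $k$ cells from each column, and exactly $k$ cells containing each symbol. -}

module Defs where

open import Data.Nat using (ℕ; zero; suc; _+_; _*_; _∸_; _≤_)
open import Data.Fin using (Fin; zero; suc)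
open import Data.Fin.Properties using (_≟_)
open import Data.Bool using (Bool; true; false; _∧_; if_then_else_)
open import Data.Product using (Σ; ∃; _×_; _,_)
open import Data.Sum using (_⊎_)
open import Relation.Binary.PropositionalEquality using (_≡_)
open import Relation.Nullary.Decidable using (⌊_⌋)
open import Function.Definitions using (Injective)

-- An n×n array with symbols from Fin n: L r c is the symbol in row r, column c.
Array : ℕ → Set
Array n = Fin n → Fin n → Fin n

IsLatinSquare : {n : ℕ} → Array n → Set
IsLatinSquare {n} L =
  ((r : Fin n) → Injective _≡_ _≡_ (λ c → L r c)) ×
  ((c : Fin n) → Injective _≡_ _≡_ (λ r → L r c))

CellSet : ℕ → Set
CellSet n = Fin n → Fin n → Bool

count : {n : ℕ} → (Fin n → Bool) → ℕ
count {zero} f = 0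
count {suc n} f = (if f zero then 1 else 0) + count (λ i → f (suc i))

sumF : {n : ℕ} → (Fin n → ℕ) → ℕ
sumF {zero} f = 0
sumF {suc n} f = f zero + sumF (λ i → f (suc i))

IsPartialTransversal : {n : ℕ} → Array n → CellSet n → Set
IsPartialTransversal {n} L T =
  (r c r' c' : Fin n) → T r c ≡ true → T r' c' ≡ true →
  (r ≡ r' ⊎ c ≡ c' ⊎ L r c ≡ L r' c') → (r ≡ r' × c ≡ c')

IsPlex : {n : ℕ} → Array n → ℕ → CellSet n → Set
IsPlex {n} L k K =
  ((r : Fin n) → count (λ c → K r c) ≡ k) ×
  ((c : Fin n) → count (λ r → K r c) ≡ k) ×
  ((s : Fin n) → sumF (λ r → count (λ c → K r c ∧ ⌊ L r c ≟ s ⌋)) ≡ k)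

IsPartition : {n d : ℕ} → (Fin d → CellSet n) → Set
IsPartition {n} {d} K =
  (r c : Fin n) →
    (Σ (Fin d) λ i → K i r c ≡ true) ×
    ((i j : Fin d) → K i r c ≡ true → K j r c ≡ true → i ≡ j)

CoverableBy : {n : ℕ} → Array n → ℕ → Set
CoverableBy {n} L m =
  Σ (Fin m → CellSet n) λ P →
    ((j : Fin m) → IsPartialTransversal L (P j)) ×
    ((r c : Fin n) → Σ (Fin m) λ j → P j r c ≡ true)

-- χ(L) ≤ b : L can be covered by at most b partial transversals
-- (χ(L) is the minimum such number, so this is exactly χ(L) ≤ b).
χ≤ : {n : ℕ} → Array n → ℕ → Set
χ≤ L b = Σ ℕ λ m → (m ≤ b) × CoverableBy L m

-- Every cell of a k-plex K shares its row, its column and its symbol with exactly k − 1 further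
-- cells of K each, so the graph joining cells of K that share a line has maximum degree at most
-- 3(k − 1).  Greedy colouring therefore splits K into 3k − 2 colour classes, and each class is a
-- partial transversal.  Doing this for every Kᵢ covers L by Σ (3kᵢ − 2) partial transversals, and
-- Σ kᵢ = n because the Kᵢ partition any single row, which meets Kᵢ in kᵢ cells.
module Submission where

open import Defs
open import Data.Nat using (ℕ; zero; suc; _+_; _*_; _∸_; _≤_; _<_; z≤n; s≤s)
open import Data.Nat.Properties
  using (+-comm; +-identityʳ; *-suc; *-distribˡ-+; *-monoʳ-≤; m∸n+n≡m; m+n∸n≡m; *-zeroʳ; n≤1+n; ≤-trans; ≤-reflexive; +-commutativeSemigroup)
import Data.Nat.Properties as ℕₚ
open import Algebra.Properties.CommutativeSemigroup +-commutativeSemigroup using (interchange)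
open import Data.Fin using (Fin; zero; suc; splitAt; _↑ˡ_; _↑ʳ_)
open import Data.Fin.Properties using (_≟_; pigeonhole; ¬∀⟶∃¬; <⇒≢; splitAt-↑ˡ; splitAt-↑ʳ)
import Data.Fin.Properties as Finₚ
open import Data.Bool using (Bool; true; false; _∧_; not; if_then_else_)
open import Data.Bool.Properties using (∧-assoc; ∧-identityʳ; ∧-zeroʳ)
open import Data.Product using (Σ; ∃; _×_; _,_; proj₁; proj₂; map₁)
open import Data.Product.Properties using (≡-dec)
open import Data.Sum using (_⊎_; inj₁; inj₂; [_,_])
open import Data.List using (List; []; _∷_; _++_; map; length; lookup)
open import Data.List.Properties using (length-map; length-++)
open import Data.List.Membership.Propositional using (_∈_; _∉_)
open import Data.List.Membership.Propositional.Properties using (∈-map⁺; ∈-map⁻; ∈-++⁺ˡ; ∈-++⁺ʳ; ∈-++⁻)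
open import Data.List.Relation.Unary.Any using (here; there; index)
open import Data.List.Relation.Unary.Any.Properties using (lookup-index)
import Data.List.Membership.DecPropositional as DecMembership
open import Function using (_∘_; id)
open import Data.Empty using (⊥-elim)
open import Relation.Nullary using (¬_; yes; no)
open import Relation.Binary.Definitions using (DecidableEquality)
open import Relation.Nullary.Decidable using (Dec; ⌊_⌋; isYes≗does; dec-true; dec-false)
open import Relation.Binary.PropositionalEquality using (_≡_; _≢_; refl; sym; trans; cong; cong₂; subst; module ≡-Reasoning)

⌊⌋-true : ∀ {A : Set} (a? : Dec A) → A → ⌊ a? ⌋ ≡ true
⌊⌋-true a? a = trans (isYes≗does a?) (dec-true a? a)

⌊⌋-false : ∀ {A : Set} (a? : Dec A) → ¬ A → ⌊ a? ⌋ ≡ false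
⌊⌋-false a? ¬a = trans (isYes≗does a?) (dec-false a? ¬a)

⌊⌋-sound : ∀ {A : Set} (a? : Dec A) → ⌊ a? ⌋ ≡ true → A
⌊⌋-sound (yes a) _ = a

∧-true⁻ : ∀ {a b} → a ∧ b ≡ true → a ≡ true × b ≡ true
∧-true⁻ {true} b≡true = refl , b≡true

indicator : Bool → ℕ
indicator b = if b then 1 else 0

sumF-cong : ∀ {n} {f g : Fin n → ℕ} → (∀ i → f i ≡ g i) → sumF f ≡ sumF g
sumF-cong {zero}  h = refl
sumF-cong {suc n} h = cong₂ _+_ (h zero) (sumF-cong (h ∘ suc))

sumF-zero : ∀ {n} {f : Fin n → ℕ} → (∀ i → f i ≡ 0) → sumF f ≡ 0
sumF-zero {zero}  h = refl
sumF-zero {suc n} h = cong₂ _+_ (h zero) (sumF-zero (h ∘ suc))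

sumF-point : ∀ {n} {f : Fin n → ℕ} (a : Fin n) → (∀ i → i ≢ a → f i ≡ 0) → sumF f ≡ f a
sumF-point {suc n} {f} zero h =
  trans (cong (f zero +_) (sumF-zero (λ i → h (suc i) λ ()))) (+-identityʳ (f zero))
sumF-point {suc n} (suc a) h =
  cong₂ _+_ (h zero λ ()) (sumF-point a (λ i i≢a → h (suc i) (i≢a ∘ Finₚ.suc-injective)))

sumF-+ : ∀ {n} (f g : Fin n → ℕ) → sumF (λ i → f i + g i) ≡ sumF f + sumF g
sumF-+ {zero}  f g = refl
sumF-+ {suc n} f g =
  trans (cong (f zero + g zero +_) (sumF-+ (f ∘ suc) (g ∘ suc)))
        (interchange (f zero) (g zero) (sumF (f ∘ suc)) (sumF (g ∘ suc)))

sumF-*ˡ : ∀ {n} (c : ℕ) (f : Fin n → ℕ) → sumF (λ i → c * f i) ≡ c * sumF f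
sumF-*ˡ {zero}  c f = sym (*-zeroʳ c)
sumF-*ˡ {suc n} c f =
  trans (cong (c * f zero +_) (sumF-*ˡ c (f ∘ suc))) (sym (*-distribˡ-+ c (f zero) _))

sumF-∸ : ∀ {d} (c : ℕ) (f : Fin d → ℕ) → (∀ i → c ≤ f i) →
  sumF (λ i → f i ∸ c) + c * d ≡ sumF f
sumF-∸ {zero}  c f h = *-zeroʳ c
sumF-∸ {suc d} c f h = begin
  (f zero ∸ c + sumF (λ i → f (suc i) ∸ c)) + c * suc d   ≡⟨ cong (f zero ∸ c + sumF (λ i → f (suc i) ∸ c) +_) (*-suc c d) ⟩
  (f zero ∸ c + sumF (λ i → f (suc i) ∸ c)) + (c + c * d) ≡⟨ interchange (f zero ∸ c) (sumF (λ i → f (suc i) ∸ c)) c (c * d) ⟩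
  (f zero ∸ c + c) + (sumF (λ i → f (suc i) ∸ c) + c * d) ≡⟨ cong₂ _+_ (m∸n+n≡m (h zero)) (sumF-∸ c (f ∘ suc) (h ∘ suc)) ⟩
  f zero + sumF (f ∘ suc)                                 ∎
  where open ≡-Reasoning

sumF-swap : ∀ {a b} (f : Fin a → Fin b → ℕ) →
  sumF (λ x → sumF (λ y → f x y)) ≡ sumF (λ y → sumF (λ x → f x y))
sumF-swap {zero} {b} f = sym (sumF-zero {b} (λ _ → refl))
sumF-swap {suc a} f =
  trans (cong (sumF (f zero) +_) (sumF-swap (f ∘ suc))) (sym (sumF-+ (f zero) _))

count≡sumF : ∀ {n} (p : Fin n → Bool) → count p ≡ sumF (indicator ∘ p)
count≡sumF {zero}  p = refl
count≡sumF {suc n} p = cong (indicator (p zero) +_) (count≡sumF (p ∘ suc))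

count-cong : ∀ {n} {p q : Fin n → Bool} → (∀ i → p i ≡ q i) → count p ≡ count q
count-cong {p = p} {q} h = trans (count≡sumF p) (trans (sumF-cong (cong indicator ∘ h)) (sym (count≡sumF q)))

count-point : ∀ {n} (p : Fin n → Bool) (a : Fin n) → count (λ i → p i ∧ ⌊ i ≟ a ⌋) ≡ indicator (p a)
count-point p a = begin
  count (λ i → p i ∧ ⌊ i ≟ a ⌋)                ≡⟨ count≡sumF (λ i → p i ∧ ⌊ i ≟ a ⌋) ⟩
  sumF (λ i → indicator (p i ∧ ⌊ i ≟ a ⌋))     ≡⟨ sumF-point a off-a ⟩
  indicator (p a ∧ ⌊ a ≟ a ⌋)                  ≡⟨ cong (λ b → indicator (p a ∧ b)) (⌊⌋-true (a ≟ a) refl) ⟩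
  indicator (p a ∧ true)                       ≡⟨ cong indicator (∧-identityʳ (p a)) ⟩
  indicator (p a)                              ∎
  where
  open ≡-Reasoning
  off-a : ∀ i → i ≢ a → indicator (p i ∧ ⌊ i ≟ a ⌋) ≡ 0
  off-a i i≢a rewrite ⌊⌋-false (i ≟ a) i≢a | ∧-zeroʳ (p i) = refl

count-split : ∀ {n} (p q : Fin n → Bool) →
  count p ≡ count (λ i → p i ∧ not (q i)) + count (λ i → p i ∧ q i)
count-split p q = begin
  count p                                       ≡⟨ count≡sumF p ⟩
  sumF (indicator ∘ p)                          ≡⟨ sumF-cong (λ i → split (p i) (q i)) ⟩
  sumF (λ i → indicator (p i ∧ not (q i)) + indicator (p i ∧ q i))
                                                ≡⟨ sumF-+ (λ i → indicator (p i ∧ not (q i))) (λ i → indicator (p i ∧ q i)) ⟩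
  sumF (λ i → indicator (p i ∧ not (q i))) + sumF (λ i → indicator (p i ∧ q i))
                                                ≡⟨ sym (cong₂ _+_ (count≡sumF (λ i → p i ∧ not (q i))) (count≡sumF (λ i → p i ∧ q i))) ⟩
  count (λ i → p i ∧ not (q i)) + count (λ i → p i ∧ q i) ∎
  where
  open ≡-Reasoning
  split : ∀ b x → indicator b ≡ indicator (b ∧ not x) + indicator (b ∧ x)
  split false x     = refl
  split true  false = refl
  split true  true  = refl

count-unique : ∀ {n} (p : Fin n → Bool) (a : Fin n) → p a ≡ true →
  (∀ i → p i ≡ true → i ≡ a) → count p ≡ 1
count-unique p a pa unique = begin
  count p                        ≡⟨ count-cong restrict ⟩
  count (λ i → p i ∧ ⌊ i ≟ a ⌋)  ≡⟨ count-point p a ⟩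
  indicator (p a)                ≡⟨ cong indicator pa ⟩
  1                              ∎
  where
  open ≡-Reasoning
  restrict : ∀ i → p i ≡ p i ∧ ⌊ i ≟ a ⌋
  restrict i with p i in pi
  ... | false = refl
  ... | true  = sym (⌊⌋-true (i ≟ a) (unique i pi))

count₂ : ∀ {a b} → (Fin a → Fin b → Bool) → ℕ
count₂ P = sumF (λ r → count (P r))

punctured : ∀ {a b} → (Fin a → Fin b → Bool) → Fin a → Fin b → Fin a → Fin b → Bool
punctured P r c r′ c′ = P r′ c′ ∧ not (⌊ r′ ≟ r ⌋ ∧ ⌊ c′ ≟ c ⌋)

count₂-split : ∀ {a b} (P Q : Fin a → Fin b → Bool) →
  count₂ P ≡ count₂ (λ r c → P r c ∧ not (Q r c)) + count₂ (λ r c → P r c ∧ Q r c)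
count₂-split P Q =
  trans (sumF-cong (λ r → count-split (P r) (Q r)))
        (sumF-+ (λ r → count (λ c → P r c ∧ not (Q r c))) (λ r → count (λ c → P r c ∧ Q r c)))

count₂-point : ∀ {a b} (P : Fin a → Fin b → Bool) (r₀ : Fin a) (c₀ : Fin b) →
  count₂ (λ r c → P r c ∧ (⌊ r ≟ r₀ ⌋ ∧ ⌊ c ≟ c₀ ⌋)) ≡ indicator (P r₀ c₀)
count₂-point P r₀ c₀ = begin
  sumF (λ r → count (λ c → P r c ∧ (⌊ r ≟ r₀ ⌋ ∧ ⌊ c ≟ c₀ ⌋)))
    ≡⟨ sumF-cong (λ r → count-cong (λ c → sym (∧-assoc (P r c) _ _))) ⟩
  sumF (λ r → count (λ c → (P r c ∧ ⌊ r ≟ r₀ ⌋) ∧ ⌊ c ≟ c₀ ⌋))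
    ≡⟨ sumF-cong (λ r → count-point (λ c → P r c ∧ ⌊ r ≟ r₀ ⌋) c₀) ⟩
  sumF (λ r → indicator (P r c₀ ∧ ⌊ r ≟ r₀ ⌋))
    ≡⟨ sym (count≡sumF (λ r → P r c₀ ∧ ⌊ r ≟ r₀ ⌋)) ⟩
  count (λ r → P r c₀ ∧ ⌊ r ≟ r₀ ⌋)
    ≡⟨ count-point (λ r → P r c₀) r₀ ⟩
  indicator (P r₀ c₀) ∎
  where open ≡-Reasoning

count₂-punctured : ∀ {a b} (P : Fin a → Fin b → Bool) (r₀ : Fin a) (c₀ : Fin b) → P r₀ c₀ ≡ true →
  suc (count₂ (punctured P r₀ c₀)) ≡ count₂ P
count₂-punctured P r₀ c₀ P₀ = begin
  suc (count₂ (punctured P r₀ c₀))                   ≡⟨ +-comm 1 _ ⟩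
  count₂ (punctured P r₀ c₀) + 1                     ≡⟨ cong (count₂ (punctured P r₀ c₀) +_) point ⟩
  count₂ (punctured P r₀ c₀) + count₂ (λ r c → P r c ∧ (⌊ r ≟ r₀ ⌋ ∧ ⌊ c ≟ c₀ ⌋))
                                                     ≡⟨ sym (count₂-split P (λ r c → ⌊ r ≟ r₀ ⌋ ∧ ⌊ c ≟ c₀ ⌋)) ⟩
  count₂ P                                           ∎
  where
  open ≡-Reasoning
  point : 1 ≡ count₂ (λ r c → P r c ∧ (⌊ r ≟ r₀ ⌋ ∧ ⌊ c ≟ c₀ ⌋))
  point = sym (trans (count₂-point P r₀ c₀) (cong indicator P₀))

count₂-row : ∀ {a b} (P : Fin a → Fin b → Bool) (r₀ : Fin a) →
  count₂ (λ r c → P r c ∧ ⌊ r ≟ r₀ ⌋) ≡ count (P r₀)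
count₂-row P r₀ =
  trans (sumF-point r₀ off-row) (count-cong (λ c → trans (cong (P r₀ c ∧_) (⌊⌋-true (r₀ ≟ r₀) refl)) (∧-identityʳ (P r₀ c))))
  where
  off-row : ∀ r → r ≢ r₀ → count (λ c → P r c ∧ ⌊ r ≟ r₀ ⌋) ≡ 0
  off-row r r≢r₀ = trans (count≡sumF (λ c → P r c ∧ ⌊ r ≟ r₀ ⌋))
    (sumF-zero (λ c → cong indicator (trans (cong (P r c ∧_) (⌊⌋-false (r ≟ r₀) r≢r₀)) (∧-zeroʳ (P r c)))))

count₂-column : ∀ {a b} (P : Fin a → Fin b → Bool) (c₀ : Fin b) →
  count₂ (λ r c → P r c ∧ ⌊ c ≟ c₀ ⌋) ≡ count (λ r → P r c₀)
count₂-column P c₀ =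
  trans (sumF-cong (λ r → count-point (P r) c₀)) (sym (count≡sumF (λ r → P r c₀)))

support : ∀ {n} → (Fin n → Bool) → List (Fin n)
support {zero}  p = []
support {suc n} p = (if p zero then zero ∷_ else id) (map suc (support (p ∘ suc)))

length-support : ∀ {n} (p : Fin n → Bool) → length (support p) ≡ count p
length-support {zero}  p = refl
length-support {suc n} p with p zero
... | true  = cong suc (trans (length-map suc (support (p ∘ suc))) (length-support (p ∘ suc)))
... | false = trans (length-map suc (support (p ∘ suc))) (length-support (p ∘ suc))

∈-support⁺ : ∀ {n} (p : Fin n → Bool) {i} → p i ≡ true → i ∈ support p
∈-support⁺ {suc n} p {zero}  pi with p zero
∈-support⁺ {suc n} p {zero}  refl | true = here refl
∈-support⁺ {suc n} p {suc i} pi with p zero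
... | true  = there (∈-map⁺ suc (∈-support⁺ (p ∘ suc) pi))
... | false = ∈-map⁺ suc (∈-support⁺ (p ∘ suc) pi)

∈-support⁻ : ∀ {n} (p : Fin n → Bool) {i} → i ∈ support p → p i ≡ true
∈-support⁻ {suc n} p {i} i∈ with p zero in p₀
∈-support⁻ {suc n} p {zero}  (here refl) | true = p₀
∈-support⁻ {suc n} p {i}     (there i∈) | true with ∈-map⁻ suc i∈
... | j , j∈ , refl = ∈-support⁻ (p ∘ suc) j∈
∈-support⁻ {suc n} p {i}     i∈         | false with ∈-map⁻ suc i∈
... | j , j∈ , refl = ∈-support⁻ (p ∘ suc) j∈

support₂ : ∀ {a b} → (Fin a → Fin b → Bool) → List (Fin a × Fin b)
support₂ {zero}  P = []
support₂ {suc a} P = map (zero ,_) (support (P zero)) ++ map (map₁ suc) (support₂ (P ∘ suc))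

length-support₂ : ∀ {a b} (P : Fin a → Fin b → Bool) → length (support₂ P) ≡ count₂ P
length-support₂ {zero}  P = refl
length-support₂ {suc a} P = begin
  length (map (zero ,_) (support (P zero)) ++ map (map₁ suc) (support₂ (P ∘ suc)))
    ≡⟨ length-++ (map (zero ,_) (support (P zero))) ⟩
  length (map (zero ,_) (support (P zero))) + length (map (map₁ suc) (support₂ (P ∘ suc)))
    ≡⟨ cong₂ _+_ (length-map (zero ,_) (support (P zero))) (length-map (map₁ suc) (support₂ (P ∘ suc))) ⟩
  length (support (P zero)) + length (support₂ (P ∘ suc))
    ≡⟨ cong₂ _+_ (length-support (P zero)) (length-support₂ (P ∘ suc)) ⟩
  count (P zero) + count₂ (P ∘ suc) ∎
  where open ≡-Reasoning

∈-support₂⁺ : ∀ {a b} (P : Fin a → Fin b → Bool) {r c} → P r c ≡ true → (r , c) ∈ support₂ P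
∈-support₂⁺ {suc a} P {zero}  Prc = ∈-++⁺ˡ (∈-map⁺ (zero ,_) (∈-support⁺ (P zero) Prc))
∈-support₂⁺ {suc a} P {suc r} Prc =
  ∈-++⁺ʳ (map (zero ,_) (support (P zero))) (∈-map⁺ (map₁ suc) (∈-support₂⁺ (P ∘ suc) Prc))

∈-support₂⁻ : ∀ {a b} (P : Fin a → Fin b → Bool) {r c} → (r , c) ∈ support₂ P → P r c ≡ true
∈-support₂⁻ {suc a} P rc∈ with ∈-++⁻ (map (zero ,_) (support (P zero))) rc∈
... | inj₁ rc∈₀ with ∈-map⁻ (zero ,_) rc∈₀
...   | c , c∈ , refl = ∈-support⁻ (P zero) c∈
∈-support₂⁻ {suc a} P rc∈ | inj₂ rc∈₊ with ∈-map⁻ (map₁ suc) rc∈₊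
...   | (r , c) , rc∈′ , refl = ∈-support₂⁻ (P ∘ suc) rc∈′

∃∉ : ∀ {m} (xs : List (Fin m)) → length xs < m → ∃ λ c → c ∉ xs
∃∉ {m} xs |xs|<m = ¬∀⟶∃¬ m (_∈ xs) (λ c → DecMembership._∈?_ _≟_ c xs) not-all
  where
  not-all : ¬ (∀ c → c ∈ xs)
  not-all all∈ with pigeonhole |xs|<m (index ∘ all∈)
  ... | i , j , i<j , same-index =
    <⇒≢ i<j (trans (lookup-index (all∈ i)) (trans (cong (lookup xs) same-index) (sym (lookup-index (all∈ j)))))

module GreedyColouring
  {V : Set} (_≟ᵥ_ : DecidableEquality V)
  (_~_ : V → V → Set) (~-sym : ∀ {u v} → u ~ v → v ~ u) (~-irrefl : ∀ {v} → ¬ v ~ v)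
  (neighbours : V → List V) (neighbours-complete : ∀ {u v} → u ~ v → v ∈ neighbours u)
  where

  ProperOn : ∀ {m} → List V → (V → Fin m) → Set
  ProperOn ws col = ∀ {u v} → u ∈ ws → v ∈ ws → u ~ v → col u ≢ col v

  recolour : ∀ {m} → (V → Fin m) → V → Fin m → V → Fin m
  recolour col w c v with v ≟ᵥ w
  ... | yes _ = c
  ... | no _  = col v

  greedy : ∀ {Δ} (ws : List V) → (∀ {w} → w ∈ ws → length (neighbours w) ≤ Δ) →
    Σ (V → Fin (suc Δ)) (ProperOn ws)
  greedy []             deg = (λ _ → zero) , λ ()
  greedy {Δ} (w ∷ ws) deg with greedy ws (deg ∘ there)
  ... | col , proper
    with ∃∉ (map col (neighbours w)) (s≤s (subst (_≤ Δ) (sym (length-map col (neighbours w))) (deg (here refl))))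
  ... | c , c-unused = recolour col w c , proper′
    where
    avoids : ∀ {v} → w ~ v → col v ≢ c
    avoids w~v same = c-unused (subst (_∈ map col (neighbours w)) same (∈-map⁺ col (neighbours-complete w~v)))
    below : ∀ {u} → u ∈ w ∷ ws → u ≢ w → u ∈ ws
    below (here u≡w) u≢w = ⊥-elim (u≢w u≡w)
    below (there u∈) _   = u∈
    proper′ : ProperOn (w ∷ ws) (recolour col w c)
    proper′ {u} {v} u∈ v∈ u~v with u ≟ᵥ w | v ≟ᵥ w
    ... | yes refl | yes refl = ⊥-elim (~-irrefl u~v)
    ... | yes refl | no _     = avoids u~v ∘ sym
    ... | no _     | yes refl = avoids (~-sym u~v)
    ... | no u≢w   | no v≢w   = proper (below u∈ u≢w) (below v∈ v≢w) u~v

Cell : ℕ → Set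
Cell n = Fin n × Fin n

_∋_ : ∀ {n} → CellSet n → Cell n → Set
K ∋ (r , c) = K r c ≡ true

Share : ∀ {n} → Array n → Cell n → Cell n → Set
Share L (r , c) (r′ , c′) = r ≡ r′ ⊎ c ≡ c′ ⊎ L r c ≡ L r′ c′

Share-sym : ∀ {n} (L : Array n) {u v : Cell n} → Share L u v → Share L v u
Share-sym L (inj₁ same-row)                = inj₁ (sym same-row)
Share-sym L (inj₂ (inj₁ same-column))      = inj₂ (inj₁ (sym same-column))
Share-sym L (inj₂ (inj₂ same-symbol))      = inj₂ (inj₂ (sym same-symbol))

punctured-true : ∀ {a b} (P : Fin a → Fin b → Bool) {r c r′ c′} →
  P r′ c′ ≡ true → (r , c) ≢ (r′ , c′) → punctured P r c r′ c′ ≡ true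
punctured-true P {r} {c} {r′} {c′} P′ distinct with r′ ≟ r | c′ ≟ c
... | yes refl | yes refl = ⊥-elim (distinct refl)
... | yes _    | no _     = trans (∧-identityʳ (P r′ c′)) P′
... | no _     | _        = trans (∧-identityʳ (P r′ c′)) P′

length-punctured : ∀ {a b k} (P : Fin a → Fin b → Bool) {r c} → P r c ≡ true → count₂ P ≡ suc k →
  length (support₂ (punctured P r c)) ≡ k
length-punctured P {r} {c} Prc |P| =
  ℕₚ.suc-injective (trans (cong suc (length-support₂ (punctured P r c))) (trans (count₂-punctured P r c Prc) |P|))

module ConflictGraph {n} (L : Array n) (K : CellSet n) where

  Conflict : Cell n → Cell n → Set
  Conflict u v = K ∋ u × K ∋ v × u ≢ v × Share L u v

  Conflict-sym : ∀ {u v} → Conflict u v → Conflict v u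
  Conflict-sym (u∈ , v∈ , u≢v , share) = v∈ , u∈ , u≢v ∘ sym , Share-sym L share

  Conflict-irrefl : ∀ {v} → ¬ Conflict v v
  Conflict-irrefl (_ , _ , v≢v , _) = v≢v refl

  inRow inColumn withSymbol : Cell n → CellSet n
  inRow      (r , c) r′ c′ = K r′ c′ ∧ ⌊ r′ ≟ r ⌋
  inColumn   (r , c) r′ c′ = K r′ c′ ∧ ⌊ c′ ≟ c ⌋
  withSymbol (r , c) r′ c′ = K r′ c′ ∧ ⌊ L r′ c′ ≟ L r c ⌋

  mates : (Cell n → CellSet n) → Cell n → List (Cell n)
  mates line (r , c) = support₂ (punctured (line (r , c)) r c)

  -- A cell may occur in more than one of the three lists; greedy colouring only needs the length bound.
  neighbours : Cell n → List (Cell n)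
  neighbours v = mates inRow v ++ mates inColumn v ++ mates withSymbol v

  mate : ∀ line {r c r′ c′} → (r , c) ≢ (r′ , c′) → line (r , c) r′ c′ ≡ true → (r′ , c′) ∈ mates line (r , c)
  mate line {r} {c} u≢v on-line = ∈-support₂⁺ (punctured (line (r , c)) r c) (punctured-true (line (r , c)) on-line u≢v)

  neighbours-complete : ∀ {u v} → Conflict u v → v ∈ neighbours u
  neighbours-complete {r , c} {r′ , c′} (_ , v∈ , u≢v , inj₁ refl) =
    ∈-++⁺ˡ (mate inRow u≢v (cong₂ _∧_ v∈ (⌊⌋-true (r′ ≟ r′) refl)))
  neighbours-complete {r , c} {r′ , c′} (_ , v∈ , u≢v , inj₂ (inj₁ refl)) =
    ∈-++⁺ʳ (mates inRow (r , c)) (∈-++⁺ˡ (mate inColumn u≢v (cong₂ _∧_ v∈ (⌊⌋-true (c′ ≟ c′) refl))))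
  neighbours-complete {r , c} {r′ , c′} (_ , v∈ , u≢v , inj₂ (inj₂ same)) =
    ∈-++⁺ʳ (mates inRow (r , c)) (∈-++⁺ʳ (mates inColumn (r , c))
      (mate withSymbol u≢v (cong₂ _∧_ v∈ (⌊⌋-true (L r′ c′ ≟ L r c) (sym same)))))

  module _ {k} (plex : IsPlex L (suc k) K) where

    degree : ∀ {v} → K ∋ v → length (neighbours v) ≤ 3 * k
    degree {r , c} Krc = ≤-reflexive (begin
      length (neighbours (r , c))
        ≡⟨ length-++ (mates inRow (r , c)) ⟩
      length (mates inRow (r , c)) + length (mates inColumn (r , c) ++ mates withSymbol (r , c))
        ≡⟨ cong (length (mates inRow (r , c)) +_) (length-++ (mates inColumn (r , c))) ⟩
      length (mates inRow (r , c)) + (length (mates inColumn (r , c)) + length (mates withSymbol (r , c)))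
        ≡⟨ cong₂ _+_ row-mates (cong₂ _+_ column-mates symbol-mates) ⟩
      k + (k + k)
        ≡⟨ cong (λ x → k + (k + x)) (sym (+-identityʳ k)) ⟩
      3 * k ∎)
      where
      open ≡-Reasoning
      row-mates : length (mates inRow (r , c)) ≡ k
      row-mates = length-punctured (inRow (r , c)) (cong₂ _∧_ Krc (⌊⌋-true (r ≟ r) refl))
        (trans (count₂-row K r) (proj₁ plex r))
      column-mates : length (mates inColumn (r , c)) ≡ k
      column-mates = length-punctured (inColumn (r , c)) (cong₂ _∧_ Krc (⌊⌋-true (c ≟ c) refl))
        (trans (count₂-column K c) (proj₁ (proj₂ plex) c))
      symbol-mates : length (mates withSymbol (r , c)) ≡ k
      symbol-mates = length-punctured (withSymbol (r , c)) (cong₂ _∧_ Krc (⌊⌋-true (L r c ≟ L r c) refl))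
        (proj₂ (proj₂ plex) (L r c))

    colouring : Σ (Cell n → Fin (suc (3 * k))) λ col → ∀ {u v} → Conflict u v → col u ≢ col v
    colouring with greedy (support₂ K) (λ w∈ → degree (∈-support₂⁻ K w∈))
      where open GreedyColouring (≡-dec _≟_ _≟_) Conflict Conflict-sym Conflict-irrefl neighbours neighbours-complete
    ... | col , proper = col , λ conflict@(u∈ , v∈ , _) → proper (∈-support₂⁺ K u∈) (∈-support₂⁺ K v∈) conflict

TransversalCover : ∀ {n} → Array n → (Fin n → Fin n → Set) → ℕ → Set
TransversalCover {n} L S m =
  Σ (Fin m → CellSet n) λ P →
    ((j : Fin m) → IsPartialTransversal L (P j)) ×
    ((r c : Fin n) → S r c → Σ (Fin m) λ j → P j r c ≡ true)

module _ {n} {L : Array n} where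

  cover-mono : ∀ {S T m} → (∀ {r c} → S r c → T r c) → TransversalCover L T m → TransversalCover L S m
  cover-mono S⊆T (P , transversal , covers) = P , transversal , λ r c → covers r c ∘ S⊆T

  cover-⊎ : ∀ {S T m₁ m₂} → TransversalCover L S m₁ → TransversalCover L T m₂ →
    TransversalCover L (λ r c → S r c ⊎ T r c) (m₁ + m₂)
  cover-⊎ {S} {T} {m₁} {m₂} (P , P-transversal , P-covers) (Q , Q-transversal , Q-covers) =
    R ∘ splitAt m₁ , R-transversal ∘ splitAt m₁ , R-covers
    where
    R : Fin m₁ ⊎ Fin m₂ → CellSet n
    R = [ P , Q ]
    R-transversal : ∀ j → IsPartialTransversal L (R j)
    R-transversal (inj₁ j) = P-transversal j
    R-transversal (inj₂ j) = Q-transversal j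
    R-covers : ∀ r c → S r c ⊎ T r c → Σ (Fin (m₁ + m₂)) λ j → R (splitAt m₁ j) r c ≡ true
    R-covers r c (inj₁ s) with P-covers r c s
    ... | j , Pj = j ↑ˡ m₂ , subst (λ i → R i r c ≡ true) (sym (splitAt-↑ˡ m₁ j m₂)) Pj
    R-covers r c (inj₂ t) with Q-covers r c t
    ... | j , Qj = m₁ ↑ʳ j , subst (λ i → R i r c ≡ true) (sym (splitAt-↑ʳ m₁ m₂ j)) Qj

  cover-⋃ : ∀ {d} {S : Fin d → Fin n → Fin n → Set} {m : Fin d → ℕ} →
    ((i : Fin d) → TransversalCover L (S i) (m i)) →
    TransversalCover L (λ r c → Σ (Fin d) λ i → S i r c) (sumF m)
  cover-⋃ {zero}  covers = (λ ()) , (λ ()) , λ r c ()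
  cover-⋃ {suc d} {S} covers = cover-mono first-or-rest (cover-⊎ (covers zero) (cover-⋃ (covers ∘ suc)))
    where
    first-or-rest : ∀ {r c} →
      Σ (Fin (suc d)) (λ i → S i r c) → S zero r c ⊎ Σ (Fin d) (λ i → S (suc i) r c)
    first-or-rest (zero  , s) = inj₁ s
    first-or-rest (suc i , s) = inj₂ (i , s)

plex-cover : ∀ {n k} {L : Array n} {K : CellSet n} → 0 < k → IsPlex L k K →
  TransversalCover L (λ r c → K r c ≡ true) (3 * k ∸ 2)
plex-cover {n} {suc k} {L} {K} _ plex =
  subst (TransversalCover L (λ r c → K r c ≡ true)) (sym (cong (_∸ 2) (*-suc 3 k)))
    (colourClass , colourClass-transversal , covers)
  where
  open ConflictGraph L K
  col : Cell n → Fin (suc (3 * k))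
  col = proj₁ (colouring plex)
  proper : ∀ {u v} → Conflict u v → col u ≢ col v
  proper = proj₂ (colouring plex)
  colourClass : Fin (suc (3 * k)) → CellSet n
  colourClass j r c = K r c ∧ ⌊ col (r , c) ≟ j ⌋
  colourClass-transversal : ∀ j → IsPartialTransversal L (colourClass j)
  colourClass-transversal j r c r′ c′ in-j in-j′ share
    with ≡-dec _≟_ _≟_ (r , c) (r′ , c′) | ∧-true⁻ in-j | ∧-true⁻ in-j′
  ... | yes refl    | _             | _             = refl , refl
  ... | no distinct | K∋u , u-has-j | K∋v , v-has-j =
    ⊥-elim (proper (K∋u , K∋v , distinct , share)
      (trans (⌊⌋-sound (col (r , c) ≟ j) u-has-j) (sym (⌊⌋-sound (col (r′ , c′) ≟ j) v-has-j))))
  covers : ∀ r c → K r c ≡ true → Σ (Fin (suc (3 * k))) λ j → colourClass j r c ≡ true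
  covers r c Krc = col (r , c) , cong₂ _∧_ Krc (⌊⌋-true (col (r , c) ≟ col (r , c)) refl)

sumF-ones : ∀ {n} → sumF {n} (λ _ → 1) ≡ n
sumF-ones {zero}  = refl
sumF-ones {suc n} = cong suc sumF-ones

plex-sizes-sum : ∀ {n d} {L : Array n} {K : Fin d → CellSet n} {k : Fin d → ℕ} →
  ((i : Fin d) → IsPlex L (k i) (K i)) → IsPartition K → Fin n → sumF k ≡ n
plex-sizes-sum {n} {K = K} {k} plex partition r = begin
  sumF k                                          ≡⟨ sumF-cong (λ i → sym (proj₁ (plex i) r)) ⟩
  sumF (λ i → count (K i r))                      ≡⟨ sumF-cong (λ i → count≡sumF (K i r)) ⟩
  sumF (λ i → sumF (λ c → indicator (K i r c)))   ≡⟨ sumF-swap (λ i c → indicator (K i r c)) ⟩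
  sumF (λ c → sumF (λ i → indicator (K i r c)))   ≡⟨ sumF-cong (λ c → sym (count≡sumF (λ i → K i r c))) ⟩
  sumF (λ c → count (λ i → K i r c))              ≡⟨ sumF-cong one-part ⟩
  sumF {n} (λ _ → 1)                              ≡⟨ sumF-ones ⟩
  n                                               ∎
  where
  open ≡-Reasoning
  one-part : ∀ c → count (λ i → K i r c) ≡ 1
  one-part c with partition r c
  ... | (i , Kirc) , unique = count-unique (λ i → K i r c) i Kirc (λ j Kjrc → unique j i Kjrc Kirc)

cover-size : ∀ {n d} (k : Fin d → ℕ) → (∀ i → 0 < k i) → sumF k ≡ n →
  sumF (λ i → 3 * k i ∸ 2) ≡ 3 * n ∸ 2 * d
cover-size {n} {d} k k>0 Σk≡n = begin
  sumF (λ i → 3 * k i ∸ 2)                  ≡⟨ sym (m+n∸n≡m _ (2 * d)) ⟩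
  sumF (λ i → 3 * k i ∸ 2) + 2 * d ∸ 2 * d  ≡⟨ cong (_∸ 2 * d) (sumF-∸ 2 (λ i → 3 * k i) (λ i → 2≤3k (k>0 i))) ⟩
  sumF (λ i → 3 * k i) ∸ 2 * d              ≡⟨ cong (_∸ 2 * d) (trans (sumF-*ˡ 3 k) (cong (3 *_) Σk≡n)) ⟩
  3 * n ∸ 2 * d                             ∎
  where
  open ≡-Reasoning
  2≤3k : ∀ {k} → 0 < k → 2 ≤ 3 * k
  2≤3k k>0 = ≤-trans (n≤1+n 2) (*-monoʳ-≤ 3 k>0)

mainTheorem2 : (n d : ℕ) (L : Array n) → IsLatinSquare L →
    (K : Fin d → CellSet n) (k : Fin d → ℕ) →
    ((i : Fin d) → 0 < k i) →
    ((i : Fin d) → IsPlex L (k i) (K i)) →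
    IsPartition K →
    χ≤ L (3 * n ∸ 2 * d)
mainTheorem2 zero    d L _ K k k>0 plex partition = 0 , z≤n , (λ ()) , (λ ()) , λ ()
mainTheorem2 (suc n) d L _ K k k>0 plex partition
  with cover-⋃ (λ i → plex-cover {L = L} (k>0 i) (plex i))
... | P , transversal , covers =
  sumF (λ i → 3 * k i ∸ 2) , ≤-reflexive (cover-size k k>0 (plex-sizes-sum {L = L} plex partition zero)) ,
  P , transversal , λ r c → covers r c (proj₁ (partition r c))
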